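{- Let $G$ be a connected graph with a modular partition $P=\{M_1,\dots,M_k\}$. Let $T$ be a MAD tree of $G$ with root $r\in M_i$. Then in every module $M_j\in P\setminus\{M_i\}$ there is at most one vertex $d\in M_j$ with $\deg_T(d)\ge 2$.
   Context: Graphs are simple, undirected, unweighted. The Wiener index is $\mathrm{W}(H)=\sum_{\{u,v\}\subseteq V(H)}\mathrm{dist}_H(u,v)$. A MAD tree of $G$ is a spanning tree of $G$ of minimum Wiener index. A module of $G$ is a set $M\subseteq V(G)$ such that every vertex outside $M$ is adjacent to all or to none of the vertices of $M$; a modular partition is a partition of $V(G)$ into $k\ge2$ modules. A vertex $r$ is a root of a MAD tree $T$ of $G$ if every path in $T$ starting at $r$ is an induced path in $G$. -}

module Defs where

open import Data.Nat using (ℕ; zero; suc; _+_; _≤_; _<ᵇ_)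
open import Data.Bool using (Bool; true; false; _∨_; _∧_; if_then_else_)
open import Data.Fin using (Fin; toℕ; _≟_)
open import Data.List using (List; []; _∷_; _++_; [_]; allFin; map)
open import Data.Nat.ListAction using (sum)
open import Data.Bool.ListAction using (any)
open import Data.List.Relation.Unary.All using (All)
open import Data.List.Relation.Unary.Unique.Propositional using (Unique)
open import Data.Product using (Σ; ∃; ∃-syntax; _×_; _,_)
open import Data.Empty using (⊥)
open import Data.Unit using (⊤)
open import Relation.Nullary using (¬_)
open import Relation.Nullary.Decidable using (⌊_⌋)
open import Relation.Binary.PropositionalEquality using (_≡_)

record Graph (n : ℕ) : Set where
  field
    adj   : Fin n → Fin n → Bool
    sym   : ∀ u v → adj u v ≡ adj v u
    irrfl : ∀ v → adj v v ≡ false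
open Graph public

module _ {n : ℕ} where

  data Walk (H : Graph n) : Fin n → Fin n → Set where
    nil  : ∀ {u} → Walk H u u
    cons : ∀ {u w v} → adj H u w ≡ true → Walk H w v → Walk H u v

  Connected : Graph n → Set
  Connected H = ∀ u v → Walk H u v

  Chain : Graph n → List (Fin n) → Set
  Chain H []           = ⊤
  Chain H (x ∷ [])     = ⊤
  Chain H (x ∷ y ∷ ys) = (adj H x y ≡ true) × Chain H (y ∷ ys)

  IsPath : Graph n → List (Fin n) → Set
  IsPath H p = Unique p × Chain H p

  HasCycle : Graph n → Set
  HasCycle H = ∃[ x ] ∃[ y ] ∃[ z ] ∃[ rest ]
    (Unique (x ∷ y ∷ z ∷ rest) × Chain H ((x ∷ y ∷ z ∷ rest) ++ [ x ]))

  Acyclic : Graph n → Set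
  Acyclic H = ¬ HasCycle H

  SubgraphOf : Graph n → Graph n → Set
  SubgraphOf T G = ∀ u v → adj T u v ≡ true → adj G u v ≡ true

  SpanningTree : Graph n → Graph n → Set
  SpanningTree G T = SubgraphOf T G × Connected T × Acyclic T

  -- reach H k u v : there is a walk of length at most k from u to v.
  reach : Graph n → ℕ → Fin n → Fin n → Bool
  reach H zero    u v = ⌊ u ≟ v ⌋
  reach H (suc k) u v = reach H k u v ∨ any (λ w → reach H k u w ∧ adj H w v) (allFin n)

  leastReach : Graph n → ℕ → ℕ → Fin n → Fin n → ℕ
  leastReach H zero     start u v = start
  leastReach H (suc f)  start u v =
    if reach H start u v then start else leastReach H f (suc start) u v

  -- Graph distance: the least length of a walk from u to v
  -- (for connected H this is always < n, so fuel n suffices).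
  dist : Graph n → Fin n → Fin n → ℕ
  dist H u v = leastReach H n 0 u v

  wiener : Graph n → ℕ
  wiener H = sum (map (λ u → sum (map (λ v →
    if toℕ u <ᵇ toℕ v then dist H u v else 0) (allFin n))) (allFin n))

  MADTree : Graph n → Graph n → Set
  MADTree G T = SpanningTree G T × (∀ T' → SpanningTree G T' → wiener T ≤ wiener T')

  degree : Graph n → Fin n → ℕ
  degree H v = sum (map (λ w → if adj H v w then 1 else 0) (allFin n))

  -- Induced in G: non-consecutive entries of the list are non-adjacent in G.
  dropOne : List (Fin n) → List (Fin n)
  dropOne []       = []
  dropOne (_ ∷ xs) = xs

  Induced : Graph n → List (Fin n) → Set
  Induced G []       = ⊤
  Induced G (x ∷ xs) = All (λ y → adj G x y ≡ false) (dropOne xs) × Induced G xs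

  IsRoot : Graph n → Graph n → Fin n → Set
  IsRoot G T r = ∀ ps → IsPath T (r ∷ ps) → Induced G (r ∷ ps)

  IsModule : Graph n → (Fin n → Set) → Set
  IsModule G M = ∀ x → ¬ M x → ∀ u v → M u → M v → adj G x u ≡ adj G x v

  -- A modular partition into k ≥ 2 modules, given by the map sending each
  -- vertex to (the index of) its block; every block is nonempty and a module.
  IsModularPartition : Graph n → (k : ℕ) → (Fin n → Fin k) → Set
  IsModularPartition G k part =
    (2 ≤ k) × (∀ j → ∃[ v ] part v ≡ j) × (∀ j → IsModule G (λ v → part v ≡ j))

{-# OPTIONS --safe #-}
module Submission where

-- Suppose d ≠ d′ lie in a module M ∌ r and both have T-degree ≥ 2.  Root paths are induced and
-- M is a module, so a root path meets M at most once.  Let z be one of d, d′ and w the other.  The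
-- branch C_z of T below z (the vertices cut off from r by z; nonempty as deg z ≥ 2) therefore
-- avoids M, so every T-neighbour of z in C_z is G-adjacent to w, and C_z can be regrafted from z
-- onto w.  This does not lengthen distances within C_z or within its complement, and for c ∈ C_z,
-- x ∉ C_z it replaces dist(c,z) + dist(z,x) by at most dist(c,z) + dist(w,x).  Minimality of the
-- Wiener index thus gives Σ_{x ∉ C_z} dist(z,x) ≤ Σ_{x ∉ C_z} dist(w,x).  But C_d and C_d′ are
-- disjoint and vertices of C_d are strictly closer to d than to d′, so the two inequalities add up
-- to a strict contradiction.

open import Defs renaming (sym to adj-sym)
open import Data.Bool using (Bool; true; false; _∨_; _∧_; if_then_else_)
open import Data.Bool.ListAction using (any)
open import Data.Bool.Properties using (T-≡)
open import Data.Empty using (⊥; ⊥-elim)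
open import Data.Fin using (Fin; zero; suc; toℕ; _≟_)
open import Data.Fin.Properties using (injective⇒≤; suc-injective; toℕ-injective)
open import Data.List using (List; []; _∷_; _++_; [_]; allFin; length; lookup; map; tabulate)
open import Data.List.Membership.Propositional using (_∈_; _∉_)
open import Data.List.Membership.Propositional.Properties using (∈-lookup; ∈-allFin)
open import Data.List.Relation.Unary.All using (All; []; _∷_)
  renaming (lookup to All-lookup; tabulate to All-tabulate)
open import Data.List.Relation.Unary.All.Properties.Core using (¬Any⇒All¬)
open import Data.List.Relation.Unary.Any using (here; there; satisfied; any?) renaming (map to Any-map)
open import Data.List.Relation.Unary.Any.Properties using (any⁻; any⁺)
open import Data.List.Relation.Unary.Unique.Propositional using (Unique; []; _∷_)
open import Data.List.Relation.Unary.Unique.Propositional.Properties using (++⁺)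
open import Data.Nat using (ℕ; zero; suc; _+_; _*_; _≤_; _<_; z≤n; s≤s; z<s; _<ᵇ_; >-nonZero)
open import Data.Nat.ListAction using () renaming (sum to sumˡ)
open import Data.Nat.Properties hiding (_≟_; suc-injective)
open import Algebra.Properties.CommutativeSemigroup +-commutativeSemigroup using (xy∙z≈xz∙y)
open import Algebra.Properties.Semiring.Sum +-*-semiring
  using (sum; sum-syntax; sum-cong-≗; ∑-distrib-+; ∑-comm; *-distribˡ-sum; *-distribʳ-sum)
open import Data.Product using (Σ; ∃; ∃-syntax; _×_; _,_; proj₁; proj₂)
open import Data.Sum using (_⊎_; inj₁; inj₂)
open import Data.Unit using (⊤; tt)
open import Function using (_∘_; id; Injective)
open import Function.Bundles using (Equivalence)
open import Relation.Binary.Definitions using (tri<; tri≈; tri>)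
open import Relation.Binary.PropositionalEquality
  using (_≡_; _≢_; refl; sym; trans; cong; cong₂; subst; subst₂; module ≡-Reasoning)
open import Relation.Nullary using (¬_; Dec; yes; no; does; contradiction; ¬?; _×-dec_)
open import Relation.Nullary.Decidable using (⌊_⌋; toWitness; fromWitness; dec-true)
open import Relation.Nullary.Reflects using (ofʸ; ofⁿ)

open Equivalence using (to; from)

∨-true⇒ : ∀ {a b} → a ∨ b ≡ true → a ≡ true ⊎ b ≡ true
∨-true⇒ {true}  _ = inj₁ refl
∨-true⇒ {false} p = inj₂ p

∧-true⇒ : ∀ {a b} → a ∧ b ≡ true → a ≡ true × b ≡ true
∧-true⇒ {true} {true} _ = refl , refl

∧-true⇐ : ∀ {a b} → a ≡ true → b ≡ true → a ∧ b ≡ true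
∧-true⇐ refl refl = refl

∨-trueʳ : ∀ a {b} → b ≡ true → a ∨ b ≡ true
∨-trueʳ true  _ = refl
∨-trueʳ false p = p

any-true⇒ : ∀ {A : Set} (p : A → Bool) xs → any p xs ≡ true → ∃[ x ] p x ≡ true
any-true⇒ p xs q with satisfied (any⁻ p xs (from T-≡ q))
... | x , px = x , to T-≡ px

any-true⇐ : ∀ {A : Set} (p : A → Bool) {xs x} → x ∈ xs → p x ≡ true → any p xs ≡ true
any-true⇐ p x∈xs px = to T-≡ (any⁺ p (Any-map (λ { refl → from T-≡ px }) x∈xs))

lookup-injective : ∀ {A : Set} {xs : List A} → Unique xs → Injective _≡_ _≡_ (lookup xs)
lookup-injective (x∉xs ∷ _) {zero}  {zero}  _ = refl
lookup-injective (x∉xs ∷ _) {zero}  {suc j} e = contradiction e (All-lookup x∉xs (∈-lookup j))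
lookup-injective (x∉xs ∷ _) {suc i} {zero}  e = contradiction (sym e) (All-lookup x∉xs (∈-lookup i))
lookup-injective (_ ∷ xs!) {suc i} {suc j} e = cong suc (lookup-injective xs! e)

unique-length≤ : ∀ {n} {xs : List (Fin n)} → Unique xs → length xs ≤ n
unique-length≤ xs! = injective⇒≤ (lookup-injective xs!)

sumˡ-map-tabulate : ∀ {m} {A : Set} (f : A → ℕ) (g : Fin m → A) → sumˡ (map f (tabulate g)) ≡ sum (f ∘ g)
sumˡ-map-tabulate {zero}  f g = refl
sumˡ-map-tabulate {suc m} f g = cong (f (g zero) +_) (sumˡ-map-tabulate f (g ∘ suc))

sumˡ-allFin : ∀ {m} (f : Fin m → ℕ) → sumˡ (map f (allFin m)) ≡ sum f
sumˡ-allFin f = sumˡ-map-tabulate f id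

∑-mono-≤ : ∀ {m} {f g : Fin m → ℕ} → (∀ i → f i ≤ g i) → sum f ≤ sum g
∑-mono-≤ {zero}  f≤g = z≤n
∑-mono-≤ {suc m} f≤g = +-mono-≤ (f≤g zero) (∑-mono-≤ (f≤g ∘ suc))

∑-mono-< : ∀ {m} {f g : Fin m → ℕ} → (∀ i → f i ≤ g i) → ∀ k → f k < g k → sum f < sum g
∑-mono-< {suc m} f≤g zero    fk<gk = +-mono-<-≤ fk<gk (∑-mono-≤ (f≤g ∘ suc))
∑-mono-< {suc m} f≤g (suc k) fk<gk = +-mono-≤-< (f≤g zero) (∑-mono-< (f≤g ∘ suc) k fk<gk)

term≤∑ : ∀ {m} (f : Fin m → ℕ) k → f k ≤ sum f
term≤∑ f zero    = m≤m+n (f zero) _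
term≤∑ f (suc k) = ≤-trans (term≤∑ (f ∘ suc) k) (m≤n+m _ (f zero))

∑∑-distrib-+ : ∀ {m k} (f g : Fin m → Fin k → ℕ) →
               ∑[ i < m ] ∑[ j < k ] (f i j + g i j) ≡ ∑[ i < m ] ∑[ j < k ] f i j + ∑[ i < m ] ∑[ j < k ] g i j
∑∑-distrib-+ {k = k} f g =
  trans (sum-cong-≗ λ i → ∑-distrib-+ (f i) (g i)) (∑-distrib-+ (λ i → ∑[ j < k ] f i j) (λ i → ∑[ j < k ] g i j))

m+m≤n+n⇒m≤n : ∀ {m n} → m + m ≤ n + n → m ≤ n
m+m≤n+n⇒m≤n m+m≤n+n = ≮⇒≥ λ n<m → <⇒≱ (+-mono-< n<m n<m) m+m≤n+n

indicator : ∀ {A : Set} → Dec A → ℕ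
indicator a? = if does a? then 1 else 0

unless : ∀ {A : Set} → Dec A → ℕ → ℕ
unless a? k = if does a? then 0 else k

count : ∀ {m} → (Fin m → Bool) → ℕ
count p = sum λ i → if p i then 1 else 0

count≥1 : ∀ {m} (p : Fin m → Bool) → 1 ≤ count p → ∃[ i ] p i ≡ true
count≥1 {suc m} p 1≤ with p zero in p0
... | true  = zero , p0
... | false = let i , pi = count≥1 (p ∘ suc) 1≤ in suc i , pi

count≥2 : ∀ {m} (p : Fin m → Bool) → 2 ≤ count p → ∃[ i ] ∃[ j ] i ≢ j × p i ≡ true × p j ≡ true
count≥2 {suc m} p 2≤ with p zero in p0
... | true  = let j , pj = count≥1 (p ∘ suc) (≤-pred 2≤) in zero , suc j , (λ ()) , p0 , pj
... | false = let i , j , i≢j , pi , pj = count≥2 (p ∘ suc) 2≤ in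
              suc i , suc j , i≢j ∘ suc-injective , pi , pj

two-neighbours : ∀ {n} (H : Graph n) v → 2 ≤ degree H v →
                 ∃[ a ] ∃[ b ] a ≢ b × adj H v a ≡ true × adj H v b ≡ true
two-neighbours H v 2≤deg = count≥2 (adj H v) (subst (2 ≤_) (sumˡ-allFin λ w → if adj H v w then 1 else 0) 2≤deg)

-- Walks and distances

module _ {n : ℕ} {H : Graph n} where

  private variable u v w x y z : Fin n

  adj⇒≢ : adj H u v ≡ true → u ≢ v
  adj⇒≢ e refl = contradiction (trans (sym e) (irrfl H _)) λ ()

  len : Walk H u v → ℕ
  len nil        = 0
  len (cons _ W) = suc (len W)

  tailᵛ : Walk H u v → List (Fin n)
  tailᵛ nil                = []
  tailᵛ (cons {w = w} _ W) = w ∷ tailᵛ W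

  vertices : Walk H u v → List (Fin n)
  vertices {u = u} W = u ∷ tailᵛ W

  length-vertices : (W : Walk H u v) → length (vertices W) ≡ suc (len W)
  length-vertices nil        = refl
  length-vertices (cons _ W) = cong suc (length-vertices W)

  last∈vertices : (W : Walk H u v) → v ∈ vertices W
  last∈vertices nil        = here refl
  last∈vertices (cons _ W) = there (last∈vertices W)

  vertices-chain : (W : Walk H u v) → Chain H (vertices W)
  vertices-chain nil        = tt
  vertices-chain (cons e W) = e , vertices-chain W

  edge : adj H u v ≡ true → Walk H u v
  edge e = cons e nil

  _++ʷ_ : Walk H u v → Walk H v w → Walk H u w
  nil      ++ʷ W′ = W′
  cons e W ++ʷ W′ = cons e (W ++ʷ W′)

  len-++ʷ : (W : Walk H u v) (W′ : Walk H v w) → len (W ++ʷ W′) ≡ len W + len W′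
  len-++ʷ nil        W′ = refl
  len-++ʷ (cons e W) W′ = cong suc (len-++ʷ W W′)

  len-snoc : (W : Walk H u v) (e : adj H v w ≡ true) → len (W ++ʷ edge e) ≡ suc (len W)
  len-snoc W e = trans (len-++ʷ W (edge e)) (+-comm (len W) 1)

  reverseʷ : Walk H u v → Walk H v u
  reverseʷ nil                        = nil
  reverseʷ (cons {u = u} {w = w} e W) = reverseʷ W ++ʷ edge (trans (adj-sym H w u) e)

  len-reverseʷ : (W : Walk H u v) → len (reverseʷ W) ≡ len W
  len-reverseʷ nil        = refl
  len-reverseʷ (cons e W) = trans (len-snoc (reverseʷ W) _) (cong suc (len-reverseʷ W))

  split : (W : Walk H u v) → x ∈ vertices W →
          Σ (Walk H u x) λ W₁ → Σ (Walk H x v) λ W₂ → len W₁ + len W₂ ≡ len W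
  split W          (here refl) = nil , W , refl
  split (cons e W) (there x∈W) with split W x∈W
  ... | W₁ , W₂ , eq = cons e W₁ , W₂ , cong suc eq

  suffix : (W : Walk H u v) → x ∈ vertices W → Unique (vertices W) →
           Σ (Walk H x v) (Unique ∘ vertices)
  suffix W          (here refl) W!       = W , W!
  suffix (cons e W) (there x∈W) (_ ∷ W!) = suffix W x∈W W!

  toPath : Walk H u v → Σ (Walk H u v) (Unique ∘ vertices)
  toPath nil = nil , [] ∷ []
  toPath (cons {u = u} e W) with toPath W
  ... | P , P! with any? (u ≟_) (vertices P)
  ...   | yes u∈P = suffix P u∈P P!
  ...   | no  u∉P = cons e P , ¬Any⇒All¬ _ u∉P ∷ P!

  path-len< : (W : Walk H u v) → Unique (vertices W) → len W < n
  path-len< W W! = subst (_≤ n) (length-vertices W) (unique-length≤ W!)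

  reach-step : ∀ k → reach H k u v ≡ true → reach H (suc k) u v ≡ true
  reach-step k r rewrite r = refl

  reach-mono : ∀ {k k′} → k ≤ k′ → reach H k u v ≡ true → reach H k′ u v ≡ true
  reach-mono {k′ = zero}   z≤n r = r
  reach-mono {k′ = suc k′} k≤ r with m≤n⇒m<n∨m≡n k≤
  ... | inj₁ (s≤s k≤k′) = reach-step k′ (reach-mono k≤k′ r)
  ... | inj₂ refl       = r

  reach-snoc : ∀ k → reach H k u w ≡ true → adj H w v ≡ true → reach H (suc k) u v ≡ true
  reach-snoc {u = u} {w = w} {v = v} k r e =
    ∨-trueʳ (reach H k u v)
            (any-true⇐ (λ x → reach H k u x ∧ adj H x v) (∈-allFin w) (∧-true⇐ r e))

  reach-extend : ∀ k → reach H k u w ≡ true → (W : Walk H w v) → reach H (k + len W) u v ≡ true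
  reach-extend {u = u} k r nil = subst (λ i → reach H i u _ ≡ true) (sym (+-identityʳ k)) r
  reach-extend {u = u} {v = v} k r (cons e W) =
    subst (λ i → reach H i u v ≡ true) (sym (+-suc k (len W))) (reach-extend (suc k) (reach-snoc k r e) W)

  reach-complete : (W : Walk H u v) → reach H (len W) u v ≡ true
  reach-complete {u = u} = reach-extend 0 (to T-≡ (fromWitness {a? = u ≟ u} refl))

  reach-sound : ∀ k → reach H k u v ≡ true → Σ (Walk H u v) λ W → len W ≤ k
  reach-sound zero r with toWitness (from T-≡ r)
  ... | refl = nil , z≤n
  reach-sound {u = u} {v = v} (suc k) r with ∨-true⇒ {reach H k u v} r
  ... | inj₁ r′ with reach-sound k r′
  ...   | W , W≤k = W , m≤n⇒m≤1+n W≤k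
  reach-sound {u = u} {v = v} (suc k) r | inj₂ r′
    with any-true⇒ (λ x → reach H k u x ∧ adj H x v) (allFin n) r′
  ... | w , rw with ∧-true⇒ {reach H k u w} rw
  ...   | r″ , e with reach-sound k r″
  ...     | W , W≤k = W ++ʷ edge e , subst (_≤ suc k) (sym (len-snoc W e)) (s≤s W≤k)

  reach-everything : Walk H u v → reach H n u v ≡ true
  reach-everything W with toPath W
  ... | P , P! = reach-mono (<⇒≤ (path-len< P P!)) (reach-complete P)

  walk? : ∀ u v → Dec (Walk H u v)
  walk? u v with reach H n u v in r
  ... | true  = yes (proj₁ (reach-sound n r))
  ... | false = no λ W → contradiction (trans (sym (reach-everything W)) r) λ ()

  leastReach-least : ∀ f s {k} → s ≤ k → reach H k u v ≡ true → leastReach H f s u v ≤ k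
  leastReach-least zero s s≤k r = s≤k
  leastReach-least {u = u} {v = v} (suc f) s s≤k r with reach H s u v in rs
  ... | true  = s≤k
  ... | false = leastReach-least f (suc s) (≤∧≢⇒< s≤k λ { refl → contradiction (trans (sym r) rs) λ () }) r

  leastReach-reaches : ∀ f s → reach H (s + f) u v ≡ true → reach H (leastReach H f s u v) u v ≡ true
  leastReach-reaches {u = u} {v = v} zero s r = subst (λ i → reach H i u v ≡ true) (+-identityʳ s) r
  leastReach-reaches {u = u} {v = v} (suc f) s r with reach H s u v in rs
  ... | true  = rs
  ... | false = leastReach-reaches f (suc s) (subst (λ i → reach H i u v ≡ true) (+-suc s f) r)

  dist≤len : (W : Walk H u v) → dist H u v ≤ len W
  dist≤len W = leastReach-least n 0 z≤n (reach-complete W)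

  geodesic : Walk H u v → Σ (Walk H u v) λ W → len W ≡ dist H u v
  geodesic {u = u} {v = v} W with reach-sound (dist H u v) (leastReach-reaches n 0 (reach-everything W))
  ... | W′ , W′≤ = W′ , ≤-antisym W′≤ (dist≤len W′)

  dist-refl : ∀ u → dist H u u ≡ 0
  dist-refl u = n≤0⇒n≡0 (dist≤len {u = u} nil)

  on-geodesic : (W : Walk H u v) → len W ≡ dist H u v → x ∈ vertices W →
                dist H u x + dist H x v ≤ dist H u v
  on-geodesic {u = u} {v = v} {x = x} W W-geo x∈W with split W x∈W
  ... | W₁ , W₂ , eq = subst (dist H u x + dist H x v ≤_) (trans eq W-geo) (+-mono-≤ (dist≤len W₁) (dist≤len W₂))

  module _ (con : Connected H) where

    dist-sym : ∀ u v → dist H u v ≡ dist H v u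
    dist-sym u v = ≤-antisym (≤-flip u v) (≤-flip v u)
      where
      ≤-flip : ∀ u v → dist H u v ≤ dist H v u
      ≤-flip u v with geodesic (con v u)
      ... | W , W-geo = subst (_ ≤_) (trans (len-reverseʷ W) W-geo) (dist≤len (reverseʷ W))

    dist-triangle : ∀ u v w → dist H u w ≤ dist H u v + dist H v w
    dist-triangle u v w with geodesic (con u v) | geodesic (con v w)
    ... | W₁ , eq₁ | W₂ , eq₂ =
      subst (_ ≤_) (trans (len-++ʷ W₁ W₂) (cong₂ _+_ eq₁ eq₂)) (dist≤len (W₁ ++ʷ W₂))

    dist-pos : u ≢ v → 0 < dist H u v
    dist-pos {u = u} {v = v} u≢v with geodesic (con u v)
    ... | nil      , _    = contradiction refl u≢v
    ... | cons _ W , W-geo = subst (0 <_) W-geo z<s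

    separated-off-geodesic : y ≢ z → dist H u z + dist H z y ≤ dist H u y →
                             dist H y z + dist H z v ≤ dist H y v →
                             dist H u y + dist H y v ≤ dist H u v → ⊥
    separated-off-geodesic {y = y} {z = z} {u = u} {v = v} y≢z uzy yzv uyv = <-irrefl refl (begin-strict
      dist H u v                                      ≤⟨ dist-triangle u z v ⟩
      dist H u z + dist H z v                         <⟨ +-monoˡ-< (dist H z v) (m<m+n _ (dist-pos (y≢z ∘ sym))) ⟩
      dist H u z + dist H z y + dist H z v            ≤⟨ +-monoʳ-≤ (dist H u z + dist H z y) (m≤n+m _ _) ⟩
      dist H u z + dist H z y + (dist H y z + dist H z v) ≤⟨ +-mono-≤ uzy yzv ⟩
      dist H u y + dist H y v                         ≤⟨ uyv ⟩
      dist H u v                                      ∎)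
      where open ≤-Reasoning

module _ {n : ℕ} {H K : Graph n} where

  mapʷ : ∀ {P : Fin n → Set} {u v} (φ : Fin n → Fin n) →
         (∀ {a b} → P a → P b → adj H a b ≡ true → adj K (φ a) (φ b) ≡ true) →
         (W : Walk H u v) → All P (vertices W) → Σ (Walk K (φ u) (φ v)) λ W′ → len W′ ≡ len W
  mapʷ φ φ-adj nil        _                   = nil , refl
  mapʷ φ φ-adj (cons e W) (pu ∷ pW@(pw ∷ _)) with mapʷ φ φ-adj W pW
  ... | W′ , eq = cons (φ-adj pu pw e) W′ , cong suc eq

-- Wiener index

module _ {n : ℕ} where

  ordered-dist : Graph n → Fin n → Fin n → ℕ
  ordered-dist H u v = if toℕ u <ᵇ toℕ v then dist H u v else 0

  totalDistance : Graph n → ℕ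
  totalDistance H = ∑[ u < n ] ∑[ v < n ] dist H u v

  wiener≡∑ : ∀ H → wiener H ≡ ∑[ u < n ] ∑[ v < n ] ordered-dist H u v
  wiener≡∑ H =
    trans (sumˡ-allFin λ u → sumˡ (map (ordered-dist H u) (allFin n))) (sum-cong-≗ λ u → sumˡ-allFin (ordered-dist H u))

  ordered-dist-split : ∀ {H} → Connected H → ∀ u v → ordered-dist H u v + ordered-dist H v u ≡ dist H u v
  ordered-dist-split con u v
    with toℕ u <ᵇ toℕ v | <ᵇ-reflects-< (toℕ u) (toℕ v) | toℕ v <ᵇ toℕ u | <ᵇ-reflects-< (toℕ v) (toℕ u)
  ... | true  | ofʸ u<v | true  | ofʸ v<u = contradiction v<u (<-asym u<v)
  ... | true  | _       | false | _       = +-identityʳ _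
  ... | false | _       | true  | _       = dist-sym con v u
  ... | false | ofⁿ u≮v | false | ofⁿ v≮u with toℕ-injective (≤-antisym (≮⇒≥ v≮u) (≮⇒≥ u≮v))
  ...   | refl = sym (dist-refl u)

  totalDistance≡wiener+wiener : ∀ {H} → Connected H → totalDistance H ≡ wiener H + wiener H
  totalDistance≡wiener+wiener {H} con = begin
    ∑[ u < n ] ∑[ v < n ] dist H u v
      ≡⟨ sum-cong-≗ (λ u → sum-cong-≗ λ v → sym (ordered-dist-split con u v)) ⟩
    ∑[ u < n ] ∑[ v < n ] (o u v + o v u)
      ≡⟨ sum-cong-≗ (λ u → ∑-distrib-+ (o u) (λ v → o v u)) ⟩
    ∑[ u < n ] (∑[ v < n ] o u v + ∑[ v < n ] o v u)
      ≡⟨ ∑-distrib-+ (λ u → ∑[ v < n ] o u v) (λ u → ∑[ v < n ] o v u) ⟩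
    ∑[ u < n ] ∑[ v < n ] o u v + ∑[ u < n ] ∑[ v < n ] o v u
      ≡⟨ cong (∑[ u < n ] ∑[ v < n ] o u v +_) (∑-comm (λ u v → o v u)) ⟩
    ∑[ u < n ] ∑[ v < n ] o u v + ∑[ u < n ] ∑[ v < n ] o u v
      ≡⟨ sym (cong₂ _+_ (wiener≡∑ H) (wiener≡∑ H)) ⟩
    wiener H + wiener H ∎
    where
    open ≡-Reasoning
    o = ordered-dist H

module _ {n : ℕ} where

  private variable u v w x y : Fin n

  adj∖ : Graph n → (x a b : Fin n) → Dec (a ≡ x) → Dec (b ≡ x) → Bool
  adj∖ H x a b (no _) (no _) = adj H a b
  adj∖ H x a b _      _      = false

  _∖_ : Graph n → Fin n → Graph n
  H ∖ x = record
    { adj   = λ a b → adj∖ H x a b (a ≟ x) (b ≟ x)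
    ; sym   = λ a b → sym∖ (a ≟ x) (b ≟ x)
    ; irrfl = λ a → irrfl∖ (a ≟ x)
    }
    where
    sym∖ : ∀ {a b} (a? : Dec (a ≡ x)) (b? : Dec (b ≡ x)) → adj∖ H x a b a? b? ≡ adj∖ H x b a b? a?
    sym∖ (no _)  (no _)  = adj-sym H _ _
    sym∖ (no _)  (yes _) = refl
    sym∖ (yes _) (no _)  = refl
    sym∖ (yes _) (yes _) = refl
    irrfl∖ : ∀ {a} (a? : Dec (a ≡ x)) → adj∖ H x a a a? a? ≡ false
    irrfl∖ (no _)  = irrfl H _
    irrfl∖ (yes _) = refl

  module _ {H : Graph n} where

    ∖-adj⇒ : adj (H ∖ x) u v ≡ true → adj H u v ≡ true × u ≢ x × v ≢ x
    ∖-adj⇒ {x = x} {u = u} {v = v} = go (u ≟ x) (v ≟ x)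
      where
      go : ∀ u? v? → adj∖ H x u v u? v? ≡ true → adj H u v ≡ true × u ≢ x × v ≢ x
      go (no u≢x) (no v≢x) e = e , u≢x , v≢x

    ∖-adj⇐ : adj H u v ≡ true → u ≢ x → v ≢ x → adj (H ∖ x) u v ≡ true
    ∖-adj⇐ {u = u} {v = v} {x = x} e u≢x v≢x = go (u ≟ x) (v ≟ x)
      where
      go : ∀ u? v? → adj∖ H x u v u? v? ≡ true
      go (no _)    (no _)    = e
      go (yes u≡x) _         = contradiction u≡x u≢x
      go (no _)    (yes v≡x) = contradiction v≡x v≢x

    lift∖ : (W : Walk H u v) → x ∉ vertices W → Walk (H ∖ x) u v
    lift∖ nil        x∉W = nil
    lift∖ (cons e W) x∉W =
      cons (∖-adj⇐ e (λ { refl → x∉W (here refl) }) (λ { refl → x∉W (there (here refl)) }))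
           (lift∖ W (x∉W ∘ there))

    avoids∖ : (W : Walk (H ∖ x) u v) → u ≢ x → x ∉ vertices W
    avoids∖ W          u≢x (here refl) = u≢x refl
    avoids∖ (cons {u = u} e W) u≢x (there x∈W) = avoids∖ W (proj₂ (proj₂ (∖-adj⇒ {u = u} e))) x∈W

    chain-snoc : ∀ {K : Graph n} → SubgraphOf K H → (W : Walk K u v) → adj H v x ≡ true →
                 Chain H (vertices W ++ [ x ])
    chain-snoc K⊆H nil        e = e , tt
    chain-snoc K⊆H (cons e′ W) e = K⊆H _ _ e′ , chain-snoc K⊆H W e

    chain-mono : ∀ {K : Graph n} → SubgraphOf H K → ∀ l → Chain H l → Chain K l
    chain-mono H⊆K []          _         = tt
    chain-mono H⊆K (_ ∷ [])     _         = tt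
    chain-mono H⊆K (a ∷ b ∷ l) (ab , bl) = H⊆K a b ab , chain-mono H⊆K (b ∷ l) bl

    detour⇒cycle : adj H x y ≡ true → adj H x w ≡ true → Walk (H ∖ x) w y → w ≢ y → HasCycle H
    detour⇒cycle xy xw W w≢y with toPath W
    ... | nil , _ = contradiction refl w≢y
    ... | P@(cons {u = w} {w = u} e P′) , P! =
      _ , _ , u , tailᵛ P′ ,
      ¬Any⇒All¬ _ (avoids∖ P (proj₁ (proj₂ (∖-adj⇒ {u = w} e)))) ∷ P! ,
      xw , chain-snoc (λ a b → proj₁ ∘ ∖-adj⇒ {u = a}) P (trans (adj-sym H _ _) xy)

-- Heights and acyclicity

module Rooted {n : ℕ} {H : Graph n} (con : Connected H) (acy : Acyclic H) (b : Fin n) where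

  private variable u v p q : Fin n

  height : Fin n → ℕ
  height u = dist H u b

  geodesic-avoids-upper : adj H v p ≡ true → height p ≤ height v →
                          (W : Walk H p b) → len W ≡ height p → v ∉ vertices W
  geodesic-avoids-upper {v = v} {p = p} vp hp≤hv W W-geo v∈W with split W v∈W
  ... | W₁ , W₂ , eq = <-irrefl refl (begin-strict
    height v                <⟨ +-mono-<-≤ (≤-trans (dist-pos con (adj⇒≢ {H = H} vp ∘ sym)) (dist≤len W₁))
                                          (dist≤len W₂) ⟩
    len W₁ + len W₂         ≡⟨ trans eq W-geo ⟩
    height p                ≤⟨ hp≤hv ⟩
    height v                ∎)
    where open ≤-Reasoning

  two-low-neighbours⇒⊥ : adj H v p ≡ true → adj H v q ≡ true → p ≢ q →
                         height p ≤ height v → height q ≤ height v → ⊥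
  two-low-neighbours⇒⊥ {p = p} {q = q} vp vq p≢q hp hq
    with geodesic (con p b) | geodesic (con q b)
  ... | Wp , Wp-geo | Wq , Wq-geo =
    acy (detour⇒cycle vq vp (lift∖ Wp (geodesic-avoids-upper vp hp Wp Wp-geo)
                               ++ʷ reverseʷ (lift∖ Wq (geodesic-avoids-upper vq hq Wq Wq-geo))) p≢q)

  parent : v ≢ b → ∃[ p ] adj H v p ≡ true × height p < height v
  parent {v = v} v≢b with geodesic (con v b)
  ... | nil , _ = contradiction refl v≢b
  ... | cons {w = p} e W , W-geo = p , e , subst (height p <_) W-geo (s≤s (dist≤len W))

  height-adj-≢ : adj H u v ≡ true → height u ≢ height v
  height-adj-≢ {u = u} {v = v} uv hu≡hv with u ≟ b
  ... | yes refl = <-irrefl (sym (trans (sym hu≡hv) (dist-refl u))) (dist-pos con (adj⇒≢ {H = H} uv ∘ sym))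
  ... | no u≢b with parent u≢b
  ...   | p , up , hp<hu =
    two-low-neighbours⇒⊥ up uv (λ { refl → <-irrefl (sym hu≡hv) hp<hu }) (<⇒≤ hp<hu) (≤-reflexive (sym hu≡hv))

  lower-neighbour-unique : adj H v p ≡ true → adj H v q ≡ true →
                           height p < height v → height q < height v → p ≡ q
  lower-neighbour-unique {p = p} {q = q} vp vq hp hq with p ≟ q
  ... | yes p≡q = p≡q
  ... | no  p≢q = ⊥-elim (two-low-neighbours⇒⊥ vp vq p≢q (<⇒≤ hp) (<⇒≤ hq))

module HeightCriterion {n : ℕ} (H : Graph n) (g : Fin n → ℕ)
  (g-adj-≢ : ∀ {a b} → adj H a b ≡ true → g a ≢ g b)
  (lower-unique : ∀ {v p q} → adj H v p ≡ true → adj H v q ≡ true → g p < g v → g q < g v → p ≡ q)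
  where

  NonBacktracking : List (Fin n) → Set
  NonBacktracking (a ∷ b ∷ c ∷ l) = a ≢ c × NonBacktracking (b ∷ c ∷ l)
  NonBacktracking _               = ⊤

  unique⇒nonBacktracking : ∀ l → Unique l → NonBacktracking l
  unique⇒nonBacktracking (a ∷ b ∷ c ∷ l) ((_ ∷ a≢c ∷ _) ∷ l!) = a≢c , unique⇒nonBacktracking (b ∷ c ∷ l) l!
  unique⇒nonBacktracking []          _ = tt
  unique⇒nonBacktracking (_ ∷ [])     _ = tt
  unique⇒nonBacktracking (_ ∷ _ ∷ []) _ = tt

  lastOf : Fin n → List (Fin n) → Fin n
  lastOf a []      = a
  lastOf _ (b ∷ l) = lastOf b l

  penultOf : Fin n → Fin n → List (Fin n) → Fin n
  penultOf a _ []      = a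
  penultOf _ b (c ∷ l) = penultOf b c l

  lastOf-∈ : ∀ a l → lastOf a l ∈ a ∷ l
  lastOf-∈ a []      = here refl
  lastOf-∈ a (b ∷ l) = there (lastOf-∈ b l)

  lastOf-snoc : ∀ a l x → lastOf a (l ++ [ x ]) ≡ x
  lastOf-snoc a []      x = refl
  lastOf-snoc a (b ∷ l) x = lastOf-snoc b l x

  penultOf-snoc : ∀ a b l x → penultOf a b (l ++ [ x ]) ≡ lastOf b l
  penultOf-snoc a b []      x = refl
  penultOf-snoc a b (c ∷ l) x = penultOf-snoc b c l x

  final-edge : ∀ a b l → Chain H (a ∷ b ∷ l) → adj H (penultOf a b l) (lastOf b l) ≡ true
  final-edge a b []      (ab , _)  = ab
  final-edge a b (c ∷ l) (_ , bcl) = final-edge b c l bcl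

  -- Once a non-backtracking chain goes up it can never come down again, since the
  -- top of a descent would have two lower neighbours.
  climb : ∀ a b l → Chain H (a ∷ b ∷ l) → NonBacktracking (a ∷ b ∷ l) → g a < g b →
          g a < g (lastOf b l) × g (penultOf a b l) < g (lastOf b l)
  climb a b []      _               _          a<b = a<b , a<b
  climb a b (c ∷ l) (ab , bc , bcl) (a≢c , nb) a<b with <-cmp (g b) (g c)
  ... | tri< b<c _ _ = let b<last , up = climb b c l (bc , bcl) nb b<c in <-trans a<b b<last , up
  ... | tri≈ _ b≡c _ = contradiction b≡c (g-adj-≢ bc)
  ... | tri> _ _ c<b = contradiction (lower-unique (trans (adj-sym H b a) ab) bc a<b c<b) a≢c

  ends-up-or-below : ∀ a b l → Chain H (a ∷ b ∷ l) → NonBacktracking (a ∷ b ∷ l) →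
                     g (penultOf a b l) < g (lastOf b l) ⊎ g (lastOf b l) < g a
  ends-up-or-below a b l abl nb with <-cmp (g a) (g b)
  ... | tri< a<b _ _ = inj₁ (proj₂ (climb a b l abl nb a<b))
  ... | tri≈ _ a≡b _ = contradiction a≡b (g-adj-≢ (proj₁ abl))
  ends-up-or-below a b []      abl nb | tri> _ _ b<a = inj₂ b<a
  ends-up-or-below a b (c ∷ l) (_ , bcl) (_ , nb) | tri> _ _ b<a with ends-up-or-below b c l bcl nb
  ... | inj₁ up     = inj₁ up
  ... | inj₂ last<b = inj₂ (<-trans last<b b<a)

  -- On a cycle x y … e x, the chain from x must end by climbing back to x; then both
  -- y and e lie below x, so they coincide.
  acyclic : Acyclic H
  acyclic (x , y , w , rest , x∉ ∷ y∉ ∷ wrest! , cycle) = case-analysis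
    where
    l = w ∷ rest ++ [ x ]
    e = lastOf w rest

    nb : NonBacktracking (x ∷ y ∷ l)
    nb = All-lookup x∉ (there (here refl)) ,
         unique⇒nonBacktracking (y ∷ l)
           (++⁺ (y∉ ∷ wrest!) ([] ∷ []) λ { (x∈ , here refl) → All-lookup x∉ x∈ refl })

    at-x : ∀ {P : Fin n → Fin n → Set} → P (penultOf x y l) (lastOf y l) → P e x
    at-x {P} = subst₂ P (penultOf-snoc x y (w ∷ rest) x) (lastOf-snoc y (w ∷ rest) x)

    case-analysis : ⊥
    case-analysis with ends-up-or-below x y l cycle nb
    ... | inj₂ below = <-irrefl refl (at-x {λ _ b → g b < g x} below)
    ... | inj₁ up with <-cmp (g x) (g y)
    ...   | tri< x<y _ _ = <-irrefl refl (at-x {λ _ b → g x < g b} (proj₁ (climb x y l cycle nb x<y)))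
    ...   | tri≈ _ x≡y _ = g-adj-≢ (proj₁ cycle) x≡y
    ...   | tri> _ _ y<x =
      All-lookup y∉ (lastOf-∈ w rest)
        (lower-unique (proj₁ cycle) (trans (adj-sym H x e) (at-x {λ a b → adj H a b ≡ true} (final-edge x y l cycle)))
                      y<x (at-x {λ a b → g a < g b} up))

-- Regrafting the branch below a vertex

module Branch {n : ℕ} {T : Graph n} (con : Connected T) (acy : Acyclic T) (r z : Fin n) where

  private variable u v c x : Fin n

  -- The proper descendants of z when T is rooted at r.
  Below : Fin n → Set
  Below v = v ≢ z × ¬ Walk (T ∖ z) r v

  below? : ∀ v → Dec (Below v)
  below? v = ¬? (v ≟ z) ×-dec ¬? (walk? r v)

  Inner : Fin n → Set
  Inner v = Below v ⊎ v ≡ z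

  ¬below⇒ : ¬ Below v → v ≡ z ⊎ Walk (T ∖ z) r v
  ¬below⇒ {v} ¬bv with v ≟ z | walk? r v
  ... | yes v≡z | _      = inj₁ v≡z
  ... | no _    | yes W  = inj₂ W
  ... | no v≢z  | no ¬W  = contradiction (v≢z , ¬W) ¬bv

  crosses-z : Below c → ¬ Below x → (W : Walk T c x) → z ∈ vertices W
  crosses-z (_ , ¬Wc) ¬bx W with any? (z ≟_) (vertices W)
  ... | yes z∈W = z∈W
  ... | no  z∉W with ¬below⇒ ¬bx
  ...   | inj₁ refl = contradiction (last∈vertices W) z∉W
  ...   | inj₂ Wx   = contradiction (Wx ++ʷ reverseʷ (lift∖ W z∉W)) ¬Wc

  through-z : Inner c → ¬ Below x → dist T c z + dist T z x ≤ dist T c x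
  through-z (inj₂ refl) ¬bx = ≤-reflexive (cong (_+ dist T z _) (dist-refl z))
  through-z {c} {x} (inj₁ bc) ¬bx with geodesic (con c x)
  ... | W , W-geo = on-geodesic W W-geo (crosses-z bc ¬bx W)

  through-z˘ : ¬ Below x → Inner c → dist T x z + dist T z c ≤ dist T x c
  through-z˘ {x} {c} ¬bx ic =
    subst₂ _≤_ (trans (+-comm (dist T c z) (dist T z x)) (cong₂ _+_ (dist-sym con z x) (dist-sym con c z)))
               (dist-sym con c x) (through-z ic ¬bx)

  geodesic-outside : ¬ Below u → ¬ Below v → (W : Walk T u v) → len W ≡ dist T u v →
                     All (¬_ ∘ Below) (vertices W)
  geodesic-outside ¬bu ¬bv W W-geo = All-tabulate λ y∈W by →
    separated-off-geodesic con (proj₁ by) (through-z˘ ¬bu (inj₁ by)) (through-z (inj₁ by) ¬bv)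
                           (on-geodesic W W-geo y∈W)

  geodesic-inside : Inner u → Inner v → (W : Walk T u v) → len W ≡ dist T u v → All Inner (vertices W)
  geodesic-inside iu iv W W-geo = All-tabulate λ {y} y∈W → inner y y∈W (below? y) (y ≟ z)
    where
    inner : ∀ y → y ∈ vertices W → Dec (Below y) → Dec (y ≡ z) → Inner y
    inner y _    (yes by) _         = inj₁ by
    inner y _    (no _)   (yes y≡z) = inj₂ y≡z
    inner y y∈W (no ¬by) (no y≢z)   = ⊥-elim
      (separated-off-geodesic con y≢z (through-z iu ¬by) (through-z˘ ¬by iv) (on-geodesic W W-geo y∈W))

  below-closer : Below v → ¬ Below x → x ≢ z → dist T z v < dist T x v
  below-closer {v} {x} bv ¬bx x≢z =
    subst₂ _<_ (dist-sym con v z) (dist-sym con v x)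
      (<-≤-trans (m<m+n (dist T v z) (dist-pos con (x≢z ∘ sym))) (through-z (inj₁ bv) ¬bx))

  some-below : 2 ≤ degree T z → ∃[ c ] Below c
  some-below 2≤deg with two-neighbours T z 2≤deg
  ... | a , b , a≢b , za , zb with below? a | below? b
  ...   | yes ba | _      = a , ba
  ...   | no _   | yes bb = b , bb
  ...   | no ¬ba | no ¬bb with ¬below⇒ ¬ba | ¬below⇒ ¬bb
  ...     | inj₁ refl | _         = contradiction refl (adj⇒≢ {H = T} za)
  ...     | inj₂ _    | inj₁ refl = contradiction refl (adj⇒≢ {H = T} zb)
  ...     | inj₂ Wa   | inj₂ Wb   = ⊥-elim (acy (detour⇒cycle zb za (reverseʷ Wa ++ʷ Wb) a≢b))

  inBranch : Fin n → ℕ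
  inBranch v = indicator (below? v)

  outside : (Fin n → ℕ) → Fin n → ℕ
  outside F v = unless (below? v) (F v)

  branchSize : ℕ
  branchSize = sum inBranch

  branchSize-pos : Below c → 0 < branchSize
  branchSize-pos {c} bc = subst (_≤ branchSize) (cong (λ b → if b then 1 else 0) (dec-true (below? c) bc))
                                (term≤∑ inBranch c)

  outsideSum : (Fin n → ℕ) → ℕ
  outsideSum F = sum (outside F)

  module Regraft {G : Graph n} (T⊆G : SubgraphOf T G) (d : Fin n) (¬bd : ¬ Below d)
                 (graftable : ∀ {c} → Below c → adj T c z ≡ true → adj G d c ≡ true) where

    -- Every edge from z down into the branch is moved to d; T has no other edges leaving the branch.
    adjʳ : ∀ {a b} → Dec (Below a) → Dec (Below b) → Bool
    adjʳ {a} {b} (yes _) (yes _) = adj T a b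
    adjʳ {a} {b} (no _)  (no _)  = adj T a b
    adjʳ {a} {b} (yes _) (no _)  = ⌊ b ≟ d ⌋ ∧ adj T a z
    adjʳ {a} {b} (no _)  (yes _) = ⌊ a ≟ d ⌋ ∧ adj T b z

    T′ : Graph n
    T′ = record
      { adj   = λ a b → adjʳ (below? a) (below? b)
      ; sym   = λ a b → symʳ (below? a) (below? b)
      ; irrfl = λ a → irrflʳ (below? a)
      }
      where
      symʳ : ∀ {a b} (a? : Dec (Below a)) (b? : Dec (Below b)) → adjʳ a? b? ≡ adjʳ b? a?
      symʳ (yes _) (yes _) = adj-sym T _ _
      symʳ (no _)  (no _)  = adj-sym T _ _
      symʳ (yes _) (no _)  = refl
      symʳ (no _)  (yes _) = refl
      irrflʳ : ∀ {a} (a? : Dec (Below a)) → adjʳ a? a? ≡ false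
      irrflʳ (yes _) = irrfl T _
      irrflʳ (no _)  = irrfl T _

    graft⇒ : ∀ {a b} → ⌊ b ≟ d ⌋ ∧ adj T a z ≡ true → b ≡ d × adj T a z ≡ true
    graft⇒ p = let b≡d , az = ∧-true⇒ p in toWitness (from T-≡ b≡d) , az

    graft⇐ : ∀ {a} → adj T a z ≡ true → ⌊ d ≟ d ⌋ ∧ adj T a z ≡ true
    graft⇐ az = ∧-true⇐ (to T-≡ (fromWitness {a? = d ≟ d} refl)) az

    T′⊆G : SubgraphOf T′ G
    T′⊆G a b = go (below? a) (below? b)
      where
      go : (a? : Dec (Below a)) (b? : Dec (Below b)) → adjʳ a? b? ≡ true → adj G a b ≡ true
      go (yes _)  (yes _)  e = T⊆G a b e
      go (no _)   (no _)   e = T⊆G a b e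
      go (yes ba) (no _)   e with graft⇒ e
      ... | refl , az = trans (adj-sym G a d) (graftable ba az)
      go (no _)   (yes bb) e with graft⇒ e
      ... | refl , bz = graftable bb bz

    outer-edge : ∀ {a b} → ¬ Below a → ¬ Below b → adj T a b ≡ true → adj T′ a b ≡ true
    outer-edge {a} {b} ¬ba ¬bb e = go (below? a) (below? b)
      where
      go : (a? : Dec (Below a)) (b? : Dec (Below b)) → adjʳ a? b? ≡ true
      go (no _)   (no _)   = e
      go (yes ba) _        = contradiction ba ¬ba
      go (no _)   (yes bb) = contradiction bb ¬bb

    φ : Fin n → Fin n
    φ y with y ≟ z
    ... | yes _ = d
    ... | no _  = y

    φ-z : φ z ≡ d
    φ-z with z ≟ z
    ... | yes _   = refl
    ... | no  z≢z = contradiction refl z≢z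

    φ-fix : ∀ {y} → y ≢ z → φ y ≡ y
    φ-fix {y} y≢z with y ≟ z
    ... | yes y≡z = contradiction y≡z y≢z
    ... | no _    = refl

    below-edge : ∀ {a b} → Below a → Below b → adj T a b ≡ true → adj T′ a b ≡ true
    below-edge {a} {b} ba bb e = go (below? a) (below? b)
      where
      go : (a? : Dec (Below a)) (b? : Dec (Below b)) → adjʳ a? b? ≡ true
      go (yes _)   (yes _)   = e
      go (no ¬ba)  _         = contradiction ba ¬ba
      go (yes _)   (no ¬bb)  = contradiction bb ¬bb

    graft-edge : ∀ {c} → Below c → adj T c z ≡ true → adj T′ c d ≡ true
    graft-edge {c} bc cz = go (below? c) (below? d)
      where
      go : (c? : Dec (Below c)) (d? : Dec (Below d)) → adjʳ c? d? ≡ true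
      go (yes _)  (no _)  = graft⇐ cz
      go (no ¬bc) _       = contradiction bc ¬bc
      go (yes _)  (yes bd) = contradiction bd ¬bd

    inner-edge : ∀ {a b} → Inner a → Inner b → adj T a b ≡ true → adj T′ (φ a) (φ b) ≡ true
    inner-edge (inj₁ ba) (inj₁ bb) e rewrite φ-fix (proj₁ ba) | φ-fix (proj₁ bb) = below-edge ba bb e
    inner-edge (inj₁ ba) (inj₂ refl) e rewrite φ-fix (proj₁ ba) | φ-z = graft-edge ba e
    inner-edge {b = b} (inj₂ refl) (inj₁ bb) e rewrite φ-fix (proj₁ bb) | φ-z =
      trans (adj-sym T′ d b) (graft-edge bb (trans (adj-sym T b z) e))
    inner-edge (inj₂ refl) (inj₂ refl) e = contradiction refl (adj⇒≢ {H = T} e)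

    outer-geodesic′ : ∀ {u v} → ¬ Below u → ¬ Below v → Σ (Walk T′ u v) λ W → len W ≡ dist T u v
    outer-geodesic′ {u} {v} ¬bu ¬bv with geodesic (con u v)
    ... | W , W-geo with mapʷ id outer-edge W (geodesic-outside ¬bu ¬bv W W-geo)
    ...   | W′ , eq = W′ , trans eq W-geo

    inner-geodesic′ : ∀ {u v} → Inner u → Inner v → Σ (Walk T′ (φ u) (φ v)) λ W → len W ≡ dist T u v
    inner-geodesic′ {u} {v} iu iv with geodesic (con u v)
    ... | W , W-geo with mapʷ φ inner-edge W (geodesic-inside iu iv W W-geo)
    ...   | W′ , eq = W′ , trans eq W-geo

    below-geodesic′ : ∀ {u v} → Below u → Below v → Σ (Walk T′ u v) λ W → len W ≡ dist T u v
    below-geodesic′ {u} {v} bu bv =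
      subst₂ (λ a b → Σ (Walk T′ a b) λ W → len W ≡ dist T u v) (φ-fix (proj₁ bu)) (φ-fix (proj₁ bv))
             (inner-geodesic′ (inj₁ bu) (inj₁ bv))

    up-to-d : ∀ {c} → Below c → Σ (Walk T′ c d) λ W → len W ≡ dist T c z
    up-to-d {c} bc =
      subst₂ (λ a b → Σ (Walk T′ a b) λ W → len W ≡ dist T c z) (φ-fix (proj₁ bc)) φ-z
             (inner-geodesic′ (inj₁ bc) (inj₂ refl))

    T′-connected : Connected T′
    T′-connected u v = to-d u ++ʷ reverseʷ (to-d v)
      where
      to-d : ∀ u → Walk T′ u d
      to-d u with below? u
      ... | yes bu = proj₁ (up-to-d bu)
      ... | no ¬bu = proj₁ (outer-geodesic′ ¬bu ¬bd)

    module R = Rooted con acy r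
    module Z = Rooted con acy z

    -- The distance to r in T′, where the branch hangs from d; it certifies that T′ is acyclic.
    heightʳ : ∀ {v} → Dec (Below v) → ℕ
    heightʳ {v} (yes _) = R.height d + Z.height v
    heightʳ {v} (no _)  = R.height v

    height′ : Fin n → ℕ
    height′ v = heightʳ (below? v)

    height′-adj-≢ : ∀ {a b} → adj T′ a b ≡ true → height′ a ≢ height′ b
    height′-adj-≢ {a} {b} = go (below? a) (below? b)
      where
      go : (a? : Dec (Below a)) (b? : Dec (Below b)) → adjʳ a? b? ≡ true → heightʳ a? ≢ heightʳ b?
      go (yes _)  (yes _)  e eq = Z.height-adj-≢ e (+-cancelˡ-≡ (R.height d) _ _ eq)
      go (no _)   (no _)   e eq = R.height-adj-≢ e eq
      go (yes ba) (no _)   e eq with graft⇒ e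
      ... | refl , _ = <-irrefl (sym eq) (m<m+n _ (dist-pos con (proj₁ ba)))
      go (no _)   (yes bb) e eq with graft⇒ e
      ... | refl , _ = <-irrefl eq (m<m+n _ (dist-pos con (proj₁ bb)))

    outer-lower : ∀ {v p} {¬bv : ¬ Below v} (p? : Dec (Below p)) → adjʳ (no ¬bv) p? ≡ true →
                  heightʳ p? < R.height v → adj T v p ≡ true × R.height p < R.height v
    outer-lower (yes _) e lt with graft⇒ e
    ... | refl , _ = contradiction (m≤m+n _ _) (<⇒≱ lt)
    outer-lower (no _)  e lt = e , lt

    -- A lower T′-neighbour of a vertex below z is a lower T-neighbour, with d standing in for z.
    contract : ∀ {p} → Dec (Below p) → Fin n
    contract {p} (yes _) = p
    contract     (no _)  = z

    below-lower : ∀ {v p} {bv : Below v} (p? : Dec (Below p)) → adjʳ (yes bv) p? ≡ true →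
                  heightʳ p? < R.height d + Z.height v →
                  adj T v (contract p?) ≡ true × Z.height (contract p?) < Z.height v
    below-lower         (yes _) e lt = e , +-cancelˡ-< (R.height d) _ _ lt
    below-lower {bv = bv} (no _) e lt =
      proj₂ (graft⇒ e) , subst (_< Z.height _) (sym (dist-refl z)) (dist-pos con (proj₁ bv))

    lower-unique′ : ∀ {v p q} → adj T′ v p ≡ true → adj T′ v q ≡ true →
                    height′ p < height′ v → height′ q < height′ v → p ≡ q
    lower-unique′ {v} {p} {q} = go (below? v) (below? p) (below? q)
      where
      resolve : ∀ {bv} (p? : Dec (Below p)) (q? : Dec (Below q)) → adjʳ (yes bv) p? ≡ true →
                adjʳ (yes bv) q? ≡ true → contract p? ≡ contract q? → p ≡ q
      resolve (yes _)  (yes _)  _  _  same = same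
      resolve (no _)   (no _)   vp vq _    = trans (proj₁ (graft⇒ vp)) (sym (proj₁ (graft⇒ vq)))
      resolve (yes bp) (no _)   _  _  same = contradiction same (proj₁ bp)
      resolve (no _)   (yes bq) _  _  same = contradiction (sym same) (proj₁ bq)
      go : (v? : Dec (Below v)) (p? : Dec (Below p)) (q? : Dec (Below q)) →
           adjʳ v? p? ≡ true → adjʳ v? q? ≡ true → heightʳ p? < heightʳ v? → heightʳ q? < heightʳ v? → p ≡ q
      go (no _) p? q? vp vq hp hq =
        let vp′ , hp′ = outer-lower p? vp hp ; vq′ , hq′ = outer-lower q? vq hq in
        R.lower-neighbour-unique vp′ vq′ hp′ hq′
      go (yes _) p? q? vp vq hp hq =
        let vp′ , hp′ = below-lower p? vp hp ; vq′ , hq′ = below-lower q? vq hq in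
        resolve p? q? vp vq (Z.lower-neighbour-unique vp′ vq′ hp′ hq′)

    T′-spanning : SpanningTree G T′
    T′-spanning = T′⊆G , T′-connected , HeightCriterion.acyclic T′ height′ (λ {a} {b} → height′-adj-≢ {a} {b})
                                                          (λ {v} {p} {q} → lower-unique′ {v} {p} {q})

    dist′-outer : ∀ {u v} → ¬ Below u → ¬ Below v → dist T′ u v ≤ dist T u v
    dist′-outer ¬bu ¬bv = let W , eq = outer-geodesic′ ¬bu ¬bv in subst (_ ≤_) eq (dist≤len W)

    dist′-below : ∀ {u v} → Below u → Below v → dist T′ u v ≤ dist T u v
    dist′-below bu bv = let W , eq = below-geodesic′ bu bv in subst (_ ≤_) eq (dist≤len W)

    dist′-across : ∀ {c x} → Below c → ¬ Below x → dist T′ c x ≤ dist T c z + dist T d x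
    dist′-across bc ¬bx =
      let W₁ , eq₁ = up-to-d bc ; W₂ , eq₂ = outer-geodesic′ ¬bd ¬bx in
      subst (_ ≤_) (trans (len-++ʷ W₁ W₂) (cong₂ _+_ eq₁ eq₂)) (dist≤len (W₁ ++ʷ W₂))

    across-bound : ∀ {c x} → Below c → ¬ Below x → dist T′ c x + dist T z x ≤ dist T c x + dist T d x
    across-bound {c} {x} bc ¬bx = begin
      dist T′ c x + dist T z x                 ≤⟨ +-monoˡ-≤ _ (dist′-across bc ¬bx) ⟩
      dist T c z + dist T d x + dist T z x     ≡⟨ xy∙z≈xz∙y (dist T c z) (dist T d x) (dist T z x) ⟩
      dist T c z + dist T z x + dist T d x     ≤⟨ +-monoˡ-≤ _ (through-z (inj₁ bc) ¬bx) ⟩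
      dist T c x + dist T d x                  ∎
      where open ≤-Reasoning

    crossing : (Fin n → ℕ) → Fin n → Fin n → ℕ
    crossing F u v = inBranch u * outside F v + inBranch v * outside F u

    pair-bound : ∀ u v → dist T′ u v + crossing (dist T z) u v ≤ dist T u v + crossing (dist T d) u v
    pair-bound u v = go (below? u) (below? v)
      where
      go : (u? : Dec (Below u)) (v? : Dec (Below v)) →
           dist T′ u v + (indicator u? * unless v? (dist T z v) + indicator v? * unless u? (dist T z u)) ≤
           dist T u v  + (indicator u? * unless v? (dist T d v) + indicator v? * unless u? (dist T d u))
      go (yes bu) (yes bv) = +-monoˡ-≤ 0 (dist′-below bu bv)
      go (no ¬bu) (no ¬bv) = +-monoˡ-≤ 0 (dist′-outer ¬bu ¬bv)
      go (yes bu) (no ¬bv) =  -- 1 * k only reduces to k + 0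
        subst₂ (λ a b → dist T′ u v + a ≤ dist T u v + b)
               (sym (trans (+-identityʳ _) (+-identityʳ _))) (sym (trans (+-identityʳ _) (+-identityʳ _)))
               (across-bound bu ¬bv)
      go (no ¬bu) (yes bv) =
        subst₂ (λ a b → a ≤ b)
               (cong₂ _+_ (dist-sym T′-connected v u) (sym (+-identityʳ _)))
               (cong₂ _+_ (dist-sym con v u) (sym (+-identityʳ _)))
               (across-bound bv ¬bu)

    crossingSum : (Fin n → ℕ) → ℕ
    crossingSum F = ∑[ u < n ] ∑[ v < n ] crossing F u v

    crossingSum≡ : ∀ F → crossingSum F ≡ branchSize * outsideSum F + branchSize * outsideSum F
    crossingSum≡ F = begin
      crossingSum F
        ≡⟨ ∑∑-distrib-+ (λ u v → inBranch u * outside F v) (λ u v → inBranch v * outside F u) ⟩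
      ∑[ u < n ] ∑[ v < n ] (inBranch u * outside F v) + ∑[ u < n ] ∑[ v < n ] (inBranch v * outside F u)
        ≡⟨ cong (∑[ u < n ] ∑[ v < n ] (inBranch u * outside F v) +_) (∑-comm λ u v → inBranch v * outside F u) ⟩
      ∑[ u < n ] ∑[ v < n ] (inBranch u * outside F v) + ∑[ u < n ] ∑[ v < n ] (inBranch u * outside F v)
        ≡⟨ cong₂ _+_ one-way one-way ⟩
      branchSize * outsideSum F + branchSize * outsideSum F ∎
      where
      open ≡-Reasoning
      one-way : ∑[ u < n ] ∑[ v < n ] (inBranch u * outside F v) ≡ branchSize * outsideSum F
      one-way = trans (sym (sum-cong-≗ λ u → *-distribˡ-sum (inBranch u) (outside F)))
                      (sym (*-distribʳ-sum (outsideSum F) inBranch))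

    regraft-saving : totalDistance T′ + crossingSum (dist T z) ≤ totalDistance T + crossingSum (dist T d)
    regraft-saving =
      subst₂ _≤_ (∑∑-distrib-+ (dist T′) (crossing (dist T z))) (∑∑-distrib-+ (dist T) (crossing (dist T d)))
             (∑-mono-≤ λ u → ∑-mono-≤ λ v → pair-bound u v)

    minimal⇒outsideSum-z≤d : (∀ T″ → SpanningTree G T″ → wiener T ≤ wiener T″) → ∃ Below →
                              outsideSum (dist T z) ≤ outsideSum (dist T d)
    minimal⇒outsideSum-z≤d minimal (c , bc) =
      *-cancelˡ-≤ branchSize {{>-nonZero (branchSize-pos bc)}}
        (m+m≤n+n⇒m≤n (subst₂ _≤_ (crossingSum≡ (dist T z)) (crossingSum≡ (dist T d)) crossings≤))
      where
      w≤w′ : wiener T ≤ wiener T′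
      w≤w′ = minimal T′ T′-spanning
      total≤ : totalDistance T ≤ totalDistance T′
      total≤ = subst₂ _≤_ (sym (totalDistance≡wiener+wiener con)) (sym (totalDistance≡wiener+wiener T′-connected))
                          (+-mono-≤ w≤w′ w≤w′)
      crossings≤ : crossingSum (dist T z) ≤ crossingSum (dist T d)
      crossings≤ = +-cancelˡ-≤ (totalDistance T) _ _ (≤-trans (+-monoˡ-≤ _ total≤) regraft-saving)

-- Modules and rooted MAD trees

module _ {n : ℕ} (G : Graph n) {M : Fin n → Set} (modM : IsModule G M) where

  induced-chain-meets-module-once : ∀ {x} xs → ¬ M x → Induced G (x ∷ xs) → Chain G (x ∷ xs) →
                                    ∀ {a b} → a ∈ xs → b ∈ xs → M a → M b → a ≡ b
  induced-chain-meets-module-once {x} (y ∷ ys) ¬Mx (x≁ys , induced) (xy , chain) a∈ b∈ Ma Mb = go a∈ b∈ Ma Mb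
    where
    -- x is adjacent to y ∈ M, hence to all of M, but to nothing after y.
    nothing-after : M y → ∀ {t} → t ∈ ys → ¬ M t
    nothing-after My t∈ys Mt with trans (sym (All-lookup x≁ys t∈ys)) (trans (sym (modM x ¬Mx y _ My Mt)) xy)
    ... | ()
    go : ∀ {a b} → a ∈ y ∷ ys → b ∈ y ∷ ys → M a → M b → a ≡ b
    go (here refl) (here refl) _  _  = refl
    go (here refl) (there b∈)  Ma Mb = ⊥-elim (nothing-after Ma b∈ Mb)
    go (there a∈)  (here refl) Ma Mb = ⊥-elim (nothing-after Mb a∈ Ma)
    go (there a∈)  (there b∈)  Ma Mb =
      induced-chain-meets-module-once ys (λ My → nothing-after My a∈ Ma) induced chain a∈ b∈ Ma Mb

module RootedMADTree {n : ℕ} {G T : Graph n} (T⊆G : SubgraphOf T G) (conT : Connected T) (acyT : Acyclic T)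
  (minimal : ∀ T″ → SpanningTree G T″ → wiener T ≤ wiener T″)
  {r : Fin n} (root : IsRoot G T r) {M : Fin n → Set} (modM : IsModule G M) (r∉M : ¬ M r) where

  private variable c d d′ v z : Fin n

  rootPath : ∀ v → Walk T r v
  rootPath v = proj₁ (toPath (conT r v))

  root-path-meets-module-once : ∀ v {a b} → a ∈ vertices (rootPath v) → b ∈ vertices (rootPath v) →
                                M a → M b → a ≡ b
  root-path-meets-module-once v a∈ b∈ Ma Mb with toPath (conT r v)
  ... | P , P! =
    induced-chain-meets-module-once G modM (tailᵛ P) r∉M (root (tailᵛ P) (P! , vertices-chain P))
      (chain-mono T⊆G (vertices P) (vertices-chain P)) (after-root a∈ Ma) (after-root b∈ Mb) Ma Mb
    where
    after-root : ∀ {a} → a ∈ vertices P → M a → a ∈ tailᵛ P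
    after-root (here refl) Mr = contradiction Mr r∉M
    after-root (there a∈)  _  = a∈

  below-on-root-path : Branch.Below conT acyT r z v → z ∈ vertices (rootPath v)
  below-on-root-path {z} {v} (_ , ¬W) with any? (z ≟_) (vertices (rootPath v))
  ... | yes z∈P = z∈P
  ... | no  z∉P = contradiction (lift∖ (rootPath v) z∉P) ¬W

  below-outside-module : M z → Branch.Below conT acyT r z c → ¬ M c
  below-outside-module {c = c} Mz bc Mc =
    proj₁ bc (root-path-meets-module-once c (last∈vertices (rootPath c)) (below-on-root-path bc) Mc Mz)

  outsideSum-z≤d : M z → M d → 2 ≤ degree T z →
                   Branch.outsideSum conT acyT r z (dist T z) ≤ Branch.outsideSum conT acyT r z (dist T d)
  outsideSum-z≤d {z} {d} Mz Md 2≤deg =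
    Regraft.minimal⇒outsideSum-z≤d {G = G} T⊆G d (λ bd → below-outside-module Mz bd Md) graftable minimal (some-below 2≤deg)
    where
    open Branch conT acyT r z
    graftable : ∀ {c} → Below c → adj T c z ≡ true → adj G d c ≡ true
    graftable {c} bc cz =
      trans (adj-sym G d c) (trans (sym (modM c (below-outside-module Mz bc) z d Mz Md)) (T⊆G c z cz))

  at-most-one-branching-vertex : M d → M d′ → 2 ≤ degree T d → 2 ≤ degree T d′ → d ≡ d′
  at-most-one-branching-vertex {d} {d′} Md Md′ 2≤deg 2≤deg′ with d ≟ d′
  ... | yes d≡d′ = d≡d′
  ... | no  d≢d′ = ⊥-elim (<-irrefl refl (<-≤-trans strict (+-mono-≤ (outsideSum-z≤d Md Md′ 2≤deg)
                                                                      (outsideSum-z≤d Md′ Md 2≤deg′))))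
    where
    module B  = Branch conT acyT r d
    module B′ = Branch conT acyT r d′

    ¬B-d′ : ¬ B.Below d′
    ¬B-d′ b = below-outside-module Md b Md′

    ¬B′-d : ¬ B′.Below d
    ¬B′-d b = below-outside-module Md′ b Md

    disjoint : B.Below v → ¬ B′.Below v
    disjoint {v} b b′ = d≢d′ (root-path-meets-module-once v (below-on-root-path b) (below-on-root-path b′) Md Md′)

    compare : ∀ v (b? : Dec (B.Below v)) (b′? : Dec (B′.Below v)) →
              unless b? (dist T d′ v) + unless b′? (dist T d v) ≤ unless b? (dist T d v) + unless b′? (dist T d′ v)
    compare v (yes b) (yes b′) = contradiction b′ (disjoint b)
    compare v (yes b) (no _)   = <⇒≤ (B.below-closer b ¬B-d′ (d≢d′ ∘ sym))
    compare v (no _)  (yes b′) = +-monoˡ-≤ 0 (<⇒≤ (B′.below-closer b′ ¬B′-d d≢d′))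
    compare v (no _)  (no _)   = ≤-reflexive (+-comm (dist T d′ v) (dist T d v))

    compare-below : ∀ {v} → B.Below v → (b? : Dec (B.Below v)) (b′? : Dec (B′.Below v)) →
                    unless b? (dist T d′ v) + unless b′? (dist T d v) < unless b? (dist T d v) + unless b′? (dist T d′ v)
    compare-below b (no ¬b) _        = contradiction b ¬b
    compare-below b (yes _) (yes b′) = contradiction b′ (disjoint b)
    compare-below b (yes _) (no _)   = B.below-closer b ¬B-d′ (d≢d′ ∘ sym)

    strict : B.outsideSum (dist T d′) + B′.outsideSum (dist T d) < B.outsideSum (dist T d) + B′.outsideSum (dist T d′)
    strict with B.some-below 2≤deg
    ... | c , bc =
      subst₂ _<_ (∑-distrib-+ (B.outside (dist T d′)) (B′.outside (dist T d)))
                 (∑-distrib-+ (B.outside (dist T d)) (B′.outside (dist T d′)))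
                 (∑-mono-< (λ v → compare v (B.below? v) (B′.below? v)) c (compare-below bc (B.below? c) (B′.below? c)))

lemma4 : ∀ {n k : ℕ} (G : Graph n) (part : Fin n → Fin k) (T : Graph n) (r : Fin n)
    → Connected G
    → IsModularPartition G k part
    → MADTree G T
    → IsRoot G T r
    → ∀ (j : Fin k) → ¬ (j ≡ part r)
    → ∀ (d d' : Fin n) → part d ≡ j → part d' ≡ j
    → 2 ≤ degree T d → 2 ≤ degree T d'
    → d ≡ d'
lemma4 G part T r _ (_ , _ , modular) ((T⊆G , conT , acyT) , minimal) root j j≢part-r d d′ =
  -- Connectivity of G is implied by T.
  RootedMADTree.at-most-one-branching-vertex T⊆G conT acyT minimal root (modular j) (j≢part-r ∘ sym)
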